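{- Let $w, s, m_0, m_1, \ldots, m_s$ be positive integers with $w \le \sum_{i=0}^s m_i$. The Cards in Piles graph $G(w,s,m_0,\ldots,m_s)$ is connected when $w=1$. When $w>1$ and $s=1$ the graph is disconnected. When $w>1$ and $s>1$, the graph is connected if and only if \[ \sum_{i=0}^s m_i \ge w + \max\{m_i : 0\le i\le s\}. \]
   Context: Cards in Piles graph: there is a set $W$ of $w$ distinct cards and $s+1$ piles numbered $0,\ldots,s$. A state is a tuple $(P_0,\ldots,P_s)$ of ordered subsets of $W$ (each read from bottom to top) that partition $W$, with $|P_i|\le m_i$ for each $i$; states differing in the order of cards within a pile are distinct. A move takes the top card of one pile and places it on top of another pile, provided no pile $i$ then has more than $m_i$ cards. $G(w,s,m_0,\ldots,m_s)$ is the undirected graph whose vertices are the states and whose edges are the moves. -}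

module Defs where

open import Data.Nat using (ℕ; suc; _+_; _≤_; _⊔_)
open import Data.Fin using (Fin)
open import Data.List using (List; []; _∷_; length; concat; map; foldr; allFin)
open import Data.Nat.ListAction using (sum)
open import Data.List.Relation.Binary.Permutation.Propositional using (_↭_)
open import Data.Product using (Σ; ∃; _×_)
open import Data.Sum using (_⊎_)
open import Relation.Binary.PropositionalEquality using (_≡_; _≢_)
open import Relation.Binary.Construct.Closure.ReflexiveTransitive using (Star)

-- A configuration of the piles 0..s with cards from W = Fin w.
-- Each pile is a list whose HEAD is the TOP card (the list is the
-- pile read from top to bottom).
Config : (w s : ℕ) → Set
Config w s = Fin (suc s) → List (Fin w)

record IsState (w s : ℕ) (m : Fin (suc s) → ℕ) (P : Config w s) : Set where
  field
    partition : concat (map P (allFin (suc s))) ↭ allFin w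
    capacity  : ∀ i → length (P i) ≤ m i

record State (w s : ℕ) (m : Fin (suc s) → ℕ) : Set where
  field
    piles   : Config w s
    isState : IsState w s m piles
open State public

Move : ∀ {w s} → Config w s → Config w s → Set
Move {w} {s} P Q =
  Σ (Fin (suc s)) λ i → Σ (Fin (suc s)) λ j → Σ (Fin w) λ c →
    i ≢ j × P i ≡ c ∷ Q i × Q j ≡ c ∷ P j ×
    (∀ k → k ≢ i → k ≢ j → Q k ≡ P k)

Edge : ∀ w s (m : Fin (suc s) → ℕ) → Config w s → Config w s → Set
Edge w s m P Q = IsState w s m P × IsState w s m Q × (Move P Q ⊎ Move Q P)

Connected : ∀ w s (m : Fin (suc s) → ℕ) → Set
Connected w s m = ∀ (S T : State w s m) → Star (Edge w s m) (piles S) (piles T)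

sumM : ∀ {s} → (Fin (suc s) → ℕ) → ℕ
sumM {s} m = sum (map m (allFin (suc s)))

maxM : ∀ {s} → (Fin (suc s) → ℕ) → ℕ
maxM {s} m = foldr _⊔_ 0 (map m (allFin (suc s)))

module Submission where

-- Sufficiency: induction on the number of free cards, the other cards being settled at the
-- bottoms of the piles.  In both states a free card c is brought, by moving free cards only,
-- to lie directly on the settled part of a pile j with the most room, and c becomes settled.
-- Since ∑ m ≥ w + max m the free cards always fit outside any single pile, so every card
-- can be uncovered; when only the two piles involved have room, a third pile not filled by
-- settled cards (it exists as s > 1) serves as a buffer.
-- Necessity: if ∑ m < w + m p then pile p is never empty, so its bottom card never moves;
-- with two piles, pile 0 read upwards followed by pile 1 read downwards never changes.
-- Relabelling a state by a transposition of cards changes these invariants.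

open import Defs
open import Data.Fin using (Fin; zero; suc)
open import Data.Fin.Permutation.Components using (transpose; transpose-inverse)
open import Data.Fin.Properties using (any?; suc-injective) renaming (_≟_ to _≟ᶠ_)
open import Data.List using (List; []; _∷_; _++_; [_]; _ʳ++_; length; concat; map; foldr; allFin; tabulate; filter; take; drop; last)
open import Data.List.Membership.Propositional using (_∈_)
open import Data.List.Membership.Propositional.Properties using (∈-∃++)
open import Data.List.Properties using (∷-injectiveˡ; ∷-injectiveʳ; ++-identityʳ; length-++; length-map; length-take; length-drop; take++drop≡id; length-ʳ++; map-ʳ++; last-map; map-tabulate; length-tabulate; filter-++)
open import Data.List.Relation.Binary.Permutation.Propositional using (_↭_; ↭-refl; ↭-sym; ↭-trans; prep)
open import Data.List.Relation.Binary.Permutation.Propositional.Properties using (↭-length; filter-↭; shift)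
open import Data.List.Relation.Unary.Any using (here; there)
import Data.Maybe
open import Data.Maybe using (just)
open import Data.Maybe.Properties using (just-injective)
open import Data.Nat using (ℕ; zero; suc; _+_; _≤_; _≥_; _>_; _<_; _∸_; _⊔_; z≤n; s≤s; _≤?_; _<?_)
open import Data.Nat.ListAction using (sum)
open import Data.Nat.Properties hiding (suc-injective)
open import Algebra.Properties.CommutativeMonoid.Sum +-0-commutativeMonoid using (sum-cong-≗; ∑-distrib-+) renaming (sum to ∑)
open import Algebra.Properties.CommutativeSemigroup +-commutativeSemigroup using (x∙yz≈y∙xz)
import Data.Product
open import Data.Product using (Σ; ∃; ∃₂; _×_; _,_; proj₁; proj₂)
import Data.Sum
open import Data.Sum using (_⊎_; inj₁; inj₂)
open import Data.Vec.Functional using (updateAt)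
open import Data.Vec.Functional.Properties using (updateAt-updates; updateAt-minimal)
open import Function using (id; _∘_)
open import Function.Bundles using (_⇔_; mk⇔)
open import Relation.Binary.Construct.Closure.ReflexiveTransitive as Star using (Star; ε; _◅_; _◅◅_)
open import Relation.Binary.PropositionalEquality hiding ([_])
open import Relation.Nullary using (¬_; yes; no; contradiction; ¬?; _×-dec_)

private
  variable
    N : ℕ

m∸n≡1+[m∸1+n] : ∀ {m n} → n < m → m ∸ n ≡ suc (m ∸ suc n)
m∸n≡1+[m∸1+n] {suc m} {zero}  _         = refl
m∸n≡1+[m∸1+n] {suc m} {suc n} (s≤s n<m) = m∸n≡1+[m∸1+n] n<m

∑-lookup : (f : Fin N → ℕ) (i : Fin N) → f i ≤ ∑ f
∑-lookup f zero    = m≤m+n _ _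
∑-lookup f (suc i) = ≤-trans (∑-lookup (f ∘ suc) i) (m≤n+m _ _)

∑-lookup₂ : (f : Fin N → ℕ) {i j : Fin N} → i ≢ j → f i + f j ≤ ∑ f
∑-lookup₂ f {zero}  {zero}  i≢j = contradiction refl i≢j
∑-lookup₂ f {zero}  {suc j} _   = +-monoʳ-≤ (f zero) (∑-lookup (f ∘ suc) j)
∑-lookup₂ f {suc i} {zero}  _   =
  subst (_≤ ∑ f) (+-comm (f zero) (f (suc i))) (+-monoʳ-≤ (f zero) (∑-lookup (f ∘ suc) i))
∑-lookup₂ f {suc i} {suc j} i≢j = ≤-trans (∑-lookup₂ (f ∘ suc) (i≢j ∘ cong suc)) (m≤n+m _ _)

∑-zero : (f : Fin N → ℕ) → (∀ k → f k ≡ 0) → ∑ f ≡ 0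
∑-zero {zero}  f f≡0 = refl
∑-zero {suc N} f f≡0 = cong₂ _+_ (f≡0 zero) (∑-zero (f ∘ suc) (f≡0 ∘ suc))

∑≡0⇒zero : (f : Fin N → ℕ) → ∑ f ≡ 0 → ∀ k → f k ≡ 0
∑≡0⇒zero f ∑f≡0 k = n≤0⇒n≡0 (subst (f k ≤_) ∑f≡0 (∑-lookup f k))

∑>0⇒∃>0 : (f : Fin N → ℕ) → 0 < ∑ f → ∃ λ k → 0 < f k
∑>0⇒∃>0 {zero}  f ()
∑>0⇒∃>0 {suc N} f ∑f>0 with f zero in eq
... | suc _ = zero , subst (0 <_) (sym eq) (s≤s z≤n)
... | zero  with k , fk>0 ← ∑>0⇒∃>0 (f ∘ suc) ∑f>0 = suc k , fk>0

∑-support₁ : (f : Fin N → ℕ) (i : Fin N) → (∀ k → k ≢ i → f k ≡ 0) → ∑ f ≤ f i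
∑-support₁ f zero    f≡0 = ≤-reflexive (trans (cong (f zero +_) (∑-zero (f ∘ suc) (λ k → f≡0 (suc k) λ ()))) (+-identityʳ _))
∑-support₁ f (suc i) f≡0 rewrite f≡0 zero (λ ()) = ∑-support₁ (f ∘ suc) i (λ k k≢i → f≡0 (suc k) (k≢i ∘ suc-injective))

∑-support₂ : (f : Fin N → ℕ) (i j : Fin N) → (∀ k → k ≢ i → k ≢ j → f k ≡ 0) → ∑ f ≤ f i + f j
∑-support₂ f zero    zero    f≡0 = ≤-trans (∑-support₁ f zero (λ k k≢0 → f≡0 k k≢0 k≢0)) (m≤m+n _ _)
∑-support₂ f zero    (suc j) f≡0 =
  +-monoʳ-≤ (f zero) (∑-support₁ (f ∘ suc) j (λ k k≢j → f≡0 (suc k) (λ ()) (k≢j ∘ suc-injective)))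
∑-support₂ f (suc i) zero    f≡0 = subst (∑ f ≤_) (+-comm (f zero) (f (suc i)))
  (+-monoʳ-≤ (f zero) (∑-support₁ (f ∘ suc) i (λ k k≢i → f≡0 (suc k) (k≢i ∘ suc-injective) (λ ()))))
∑-support₂ f (suc i) (suc j) f≡0 rewrite f≡0 zero (λ ()) (λ ()) =
  ∑-support₂ (f ∘ suc) i j (λ k k≢i k≢j → f≡0 (suc k) (k≢i ∘ suc-injective) (k≢j ∘ suc-injective))

∑-update : (f g : Fin N → ℕ) (j : Fin N) {d : ℕ} → (∀ k → k ≢ j → f k ≡ g k) → g j ≡ d + f j → ∑ g ≡ d + ∑ f
∑-update f g zero    {d} f≗g gⱼ rewrite gⱼ | sum-cong-≗ (λ k → f≗g (suc k) λ ()) = +-assoc d (f zero) _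
∑-update f g (suc j) {d} f≗g gⱼ rewrite sym (f≗g zero (λ ()))
                                      | ∑-update (f ∘ suc) (g ∘ suc) j (λ k k≢j → f≗g (suc k) (k≢j ∘ suc-injective)) gⱼ =
  x∙yz≈y∙xz (f zero) d (∑ (f ∘ suc))

∑-transfer : (f g : Fin N → ℕ) {i j : Fin N} {e : ℕ} → i ≢ j → f i ≡ e + g i → g j ≡ e + f j →
             (∀ k → k ≢ i → k ≢ j → f k ≡ g k) → ∑ f ≡ ∑ g
∑-transfer {N} f g {i} {j} {e} i≢j fᵢ gⱼ f≗g =
  trans (∑-update h f i h≗f (trans fᵢ (cong (e +_) (sym hᵢ))))
        (sym (∑-update h g j h≗g (trans gⱼ (cong (e +_) (sym (updateAt-minimal j i f (i≢j ∘ sym)))))))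
  where
  h : Fin N → ℕ
  h = updateAt f i (λ _ → g i)
  hᵢ : h i ≡ g i
  hᵢ = updateAt-updates i f
  h≗f : ∀ k → k ≢ i → h k ≡ f k
  h≗f k k≢i = updateAt-minimal k i f k≢i
  h≗g : ∀ k → k ≢ j → h k ≡ g k
  h≗g k k≢j with k ≟ᶠ i
  ... | yes refl = hᵢ
  ... | no  k≢i  = trans (h≗f k k≢i) (f≗g k k≢i k≢j)

sum-tabulate : (f : Fin N → ℕ) → sum (tabulate f) ≡ ∑ f
sum-tabulate {zero}  f = refl
sum-tabulate {suc N} f = cong (f zero +_) (sum-tabulate (f ∘ suc))

sumM≡∑ : ∀ {s} (m : Fin (suc s) → ℕ) → sumM m ≡ ∑ m
sumM≡∑ m = trans (cong sum (map-tabulate id m)) (sum-tabulate m)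

foldr-⊔-tabulate-≥ : (f : Fin N → ℕ) (i : Fin N) → f i ≤ foldr _⊔_ 0 (tabulate f)
foldr-⊔-tabulate-≥ f zero    = m≤m⊔n _ _
foldr-⊔-tabulate-≥ f (suc i) = ≤-trans (foldr-⊔-tabulate-≥ (f ∘ suc) i) (m≤n⊔m _ _)

foldr-⊔-tabulate-attained : (f : Fin (suc N) → ℕ) → ∃ λ p → foldr _⊔_ 0 (tabulate f) ≡ f p
foldr-⊔-tabulate-attained {zero}  f = zero , ⊔-identityʳ (f zero)
foldr-⊔-tabulate-attained {suc N} f with p , eq ← foldr-⊔-tabulate-attained (f ∘ suc)
                                      | ≤-total (f zero) (foldr _⊔_ 0 (tabulate (f ∘ suc)))
... | inj₁ f₀≤ = suc p , trans (m≤n⇒m⊔n≡n f₀≤) eq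
... | inj₂ f₀≥ = zero , m≥n⇒m⊔n≡m f₀≥

argmax : (f : Fin (suc N) → ℕ) → ∃ λ p → ∀ k → f k ≤ f p
argmax f with p , eq ← foldr-⊔-tabulate-attained f = p , λ k → subst (f k ≤_) eq (foldr-⊔-tabulate-≥ f k)

maxM-attained : ∀ {s} (m : Fin (suc s) → ℕ) → ∃ λ p → maxM m ≡ m p
maxM-attained m = subst (λ xs → ∃ λ p → foldr _⊔_ 0 xs ≡ m p) (sym (map-tabulate id m)) (foldr-⊔-tabulate-attained m)

≤maxM : ∀ {s} (m : Fin (suc s) → ℕ) i → m i ≤ maxM m
≤maxM m i = subst (m i ≤_) (cong (foldr _⊔_ 0) (sym (map-tabulate id m))) (foldr-⊔-tabulate-≥ m i)

PositiveBesides : (Fin N → ℕ) → Set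
PositiveBesides K = ∀ a b → ∃ λ k → k ≢ a × k ≢ b × 0 < K k

-- If K j ≤ 1 then every value of K′ is at most 1, so 3 ≤ ∑ K′ leaves a positive one outside any a, b.
PositiveBesides-pred : (K K′ : Fin N → ℕ) (j : Fin N) → (∀ k → K k ≤ K j) → K j ≡ suc (K′ j) →
                       (∀ k → k ≢ j → K′ k ≡ K k) → 3 ≤ ∑ K′ → PositiveBesides K → PositiveBesides K′
PositiveBesides-pred K K′ j max Kⱼ K′≗K 3≤∑ besides a b with 2 ≤? K j
... | yes 2≤Kⱼ with k , k≢a , k≢b , 0<Kₖ ← besides a b = k , k≢a , k≢b , positive
  where
  positive : 0 < K′ k
  positive with k ≟ᶠ j
  ... | yes refl = ≤-pred (subst (2 ≤_) Kⱼ 2≤Kⱼ)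
  ... | no  k≢j  = subst (0 <_) (sym (K′≗K k k≢j)) 0<Kₖ
... | no Kⱼ≱2 with any? (λ k → ¬? (k ≟ᶠ a) ×-dec (¬? (k ≟ᶠ b) ×-dec (0 <? K′ k)))
...   | yes found = found
...   | no  none  = contradiction (begin
  ∑ K′        ≤⟨ ∑-support₂ K′ a b (λ k k≢a k≢b → n≤0⇒n≡0 (≮⇒≥ (λ 0<K′ₖ → none (k , k≢a , k≢b , 0<K′ₖ)))) ⟩
  K′ a + K′ b ≤⟨ +-mono-≤ (K′≤1 a) (K′≤1 b) ⟩
  2           ∎) (<⇒≱ 3≤∑)
  where
  open ≤-Reasoning
  K′≤1 : ∀ k → K′ k ≤ 1
  K′≤1 k with k ≟ᶠ j
  ... | yes refl = ≤-trans (n≤1+n _) (≤-trans (≤-reflexive (sym Kⱼ)) (≤-pred (≰⇒> Kⱼ≱2)))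
  ... | no  k≢j  = ≤-trans (≤-reflexive (K′≗K k k≢j)) (≤-trans (max k) (≤-pred (≰⇒> Kⱼ≱2)))

transpose-matchˡ : (i j : Fin N) → transpose i j i ≡ j
transpose-matchˡ i j with i ≟ᶠ i
... | yes _   = refl
... | no  i≢i = contradiction refl i≢i

another : ∀ {n} → 2 ≤ n → (a : Fin n) → ∃ λ b → b ≢ a
another {suc (suc _)} _ zero    = suc zero , λ ()
another {suc (suc _)} _ (suc _) = zero , λ ()
another {suc zero}    (s≤s ()) _

another₂ : ∀ {n} → 3 ≤ n → (a b : Fin n) → ∃ λ k → k ≢ a × k ≢ b
another₂ {suc (suc (suc _))} _ zero          zero          = suc zero , (λ ()) , (λ ())
another₂ {suc (suc (suc _))} _ zero          (suc zero)    = suc (suc zero) , (λ ()) , (λ ())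
another₂ {suc (suc (suc _))} _ zero          (suc (suc _)) = suc zero , (λ ()) , (λ ())
another₂ {suc (suc (suc _))} _ (suc zero)    zero          = suc (suc zero) , (λ ()) , (λ ())
another₂ {suc (suc (suc _))} _ (suc (suc _)) zero          = suc zero , (λ ()) , (λ ())
another₂ {suc (suc (suc _))} _ (suc _)       (suc _)       = zero , (λ ()) , (λ ())
another₂ {suc (suc zero)}    (s≤s (s≤s ())) _ _
another₂ {suc zero}          (s≤s ())       _ _

∷⇒0<length : ∀ {A : Set} {l : List A} {x xs} → l ≡ x ∷ xs → 0 < length l
∷⇒0<length refl = s≤s z≤n

length≡0⇒[] : ∀ {A : Set} (l : List A) → length l ≡ 0 → l ≡ []
length≡0⇒[] [] _ = refl

0<length⇒∷ : ∀ {A : Set} {l : List A} → 0 < length l → ∃₂ λ x xs → l ≡ x ∷ xs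
0<length⇒∷ {l = x ∷ xs} _ = x , xs , refl

0<length⇒∃∈ : ∀ {A : Set} {l : List A} → 0 < length l → ∃ λ x → x ∈ l
0<length⇒∃∈ {l = x ∷ _} _ = x , here refl

last-∷ : ∀ {A : Set} {c : A} l → 0 < length l → last (c ∷ l) ≡ last l
last-∷ (_ ∷ _) _ = refl

last-just : ∀ {A : Set} {l : List A} → 0 < length l → ∃ λ x → last l ≡ just x
last-just {l = x ∷ []}     _ = x , refl
last-just {l = _ ∷ y ∷ ys} _ = last-just {l = y ∷ ys} (s≤s z≤n)

fill : ∀ {A : Set} → (Fin N → ℕ) → List A → Fin N → List A
fill f xs zero    = take (f zero) xs
fill f xs (suc k) = fill (f ∘ suc) (drop (f zero) xs) k

fill-concat : ∀ {A : Set} (f : Fin N → ℕ) (xs : List A) → length xs ≤ ∑ f → concat (tabulate (fill f xs)) ≡ xs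
fill-concat {zero}  f []       _   = refl
fill-concat {suc N} f xs       fit = trans
  (cong (take (f zero) xs ++_) (fill-concat (f ∘ suc) (drop (f zero) xs) (begin
    length (drop (f zero) xs)   ≡⟨ length-drop (f zero) xs ⟩
    length xs ∸ f zero          ≤⟨ ∸-monoˡ-≤ (f zero) fit ⟩
    f zero + ∑ (f ∘ suc) ∸ f zero ≡⟨ m+n∸m≡n (f zero) _ ⟩
    ∑ (f ∘ suc)                 ∎)))
  (take++drop≡id (f zero) xs)
  where open ≤-Reasoning

length-fill : ∀ {A : Set} (f : Fin N → ℕ) (xs : List A) k → length (fill f xs k) ≤ f k
length-fill f xs zero    = ≤-trans (≤-reflexive (length-take (f zero) xs)) (m⊓n≤m _ _)
length-fill f xs (suc k) = length-fill (f ∘ suc) (drop (f zero) xs) k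

length-concat-tabulate : ∀ {A : Set} (f : Fin N → List A) → length (concat (tabulate f)) ≡ ∑ (λ k → length (f k))
length-concat-tabulate {zero}  f = refl
length-concat-tabulate {suc N} f = trans (length-++ (f zero)) (cong (length (f zero) +_) (length-concat-tabulate (f ∘ suc)))

occ : Fin N → List (Fin N) → ℕ
occ x xs = length (filter (x ≟ᶠ_) xs)

occ-++ : (x : Fin N) (xs ys : List (Fin N)) → occ x (xs ++ ys) ≡ occ x xs + occ x ys
occ-++ x xs ys = trans (cong length (filter-++ (x ≟ᶠ_) xs ys)) (length-++ (filter (x ≟ᶠ_) xs))

occ-↭ : (x : Fin N) {xs ys : List (Fin N)} → xs ↭ ys → occ x xs ≡ occ x ys
occ-↭ x xs↭ys = ↭-length (filter-↭ (x ≟ᶠ_) xs↭ys)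

∈⇒occ>0 : {x : Fin N} {xs : List (Fin N)} → x ∈ xs → 0 < occ x xs
∈⇒occ>0 {x = x} {y ∷ ys} x∈ with x ≟ᶠ y | x∈
... | yes _   | _          = s≤s z≤n
... | no  _   | there x∈ys = ∈⇒occ>0 x∈ys
... | no  x≢y | here x≡y   = contradiction x≡y x≢y

occ>0⇒∈ : {x : Fin N} (xs : List (Fin N)) → 0 < occ x xs → x ∈ xs
occ>0⇒∈ {x = x} (y ∷ ys) occ>0 with x ≟ᶠ y
... | yes x≡y = here x≡y
... | no  _   = there (occ>0⇒∈ ys occ>0)

occ⇒↭ : (xs ys : List (Fin N)) → (∀ x → occ x xs ≡ occ x ys) → xs ↭ ys
occ⇒↭ []       []       _  = ↭-refl
occ⇒↭ []       (y ∷ ys) eq = contradiction (eq y) (<⇒≢ (∈⇒occ>0 {x = y} {y ∷ ys} (here refl)))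
occ⇒↭ (x ∷ xs) ys       eq with as , bs , refl ← ∈-∃++ (occ>0⇒∈ ys (subst (0 <_) (eq x) (∈⇒occ>0 {x = x} {x ∷ xs} (here refl)))) =
  ↭-trans (prep x (occ⇒↭ xs (as ++ bs) occ-rest)) (↭-sym (shift x as bs))
  where
  occ-rest : ∀ z → occ z xs ≡ occ z (as ++ bs)
  occ-rest z = +-cancelˡ-≡ (occ z [ x ]) _ _ (begin
    occ z [ x ] + occ z xs              ≡⟨ occ-++ z [ x ] xs ⟨
    occ z (x ∷ xs)                      ≡⟨ eq z ⟩
    occ z (as ++ [ x ] ++ bs)           ≡⟨ occ-++ z as ([ x ] ++ bs) ⟩
    occ z as + occ z ([ x ] ++ bs)      ≡⟨ cong (occ z as +_) (occ-++ z [ x ] bs) ⟩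
    occ z as + (occ z [ x ] + occ z bs) ≡⟨ x∙yz≈y∙xz (occ z as) (occ z [ x ]) (occ z bs) ⟩
    occ z [ x ] + (occ z as + occ z bs) ≡⟨ cong (occ z [ x ] +_) (occ-++ z as bs) ⟨
    occ z [ x ] + occ z (as ++ bs)      ∎)
    where open ≡-Reasoning

occ-map : ∀ {N′} (f : Fin N → Fin N′) → (∀ {a b} → f a ≡ f b → a ≡ b) →
          (x : Fin N) (xs : List (Fin N)) → occ (f x) (map f xs) ≡ occ x xs
occ-map f f-inj x []       = refl
occ-map f f-inj x (y ∷ ys) with f x ≟ᶠ f y | x ≟ᶠ y
... | yes _     | yes _   = cong suc (occ-map f f-inj x ys)
... | no  _     | no  _   = occ-map f f-inj x ys
... | yes fx≡fy | no  x≢y = contradiction (f-inj fx≡fy) x≢y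
... | no  fx≢fy | yes x≡y = contradiction (cong f x≡y) fx≢fy

occ-zero-map-suc : (xs : List (Fin N)) → occ zero (map suc xs) ≡ 0
occ-zero-map-suc []       = refl
occ-zero-map-suc (_ ∷ xs) = occ-zero-map-suc xs

occ-allFin : (x : Fin N) → occ x (allFin N) ≡ 1
occ-allFin {suc N} zero    = cong suc (trans (cong (occ {suc N} zero) (sym (map-tabulate id suc))) (occ-zero-map-suc (allFin N)))
occ-allFin {suc N} (suc x) = begin
  occ (suc x) (tabulate suc)         ≡⟨ cong (occ (suc x)) (sym (map-tabulate id suc)) ⟩
  occ (suc x) (map suc (allFin N))   ≡⟨ occ-map suc suc-injective x (allFin N) ⟩
  occ x (allFin N)                   ≡⟨ occ-allFin x ⟩
  1                                  ∎
  where open ≡-Reasoning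

occ-concat : ∀ {w} (x : Fin w) (f : Fin N → List (Fin w)) → occ x (concat (tabulate f)) ≡ ∑ (λ k → occ x (f k))
occ-concat {zero}  x f = refl
occ-concat {suc N} x f = trans (occ-++ x (f zero) _) (cong (occ x (f zero) +_) (occ-concat x (f ∘ suc)))

module Piles (w s : ℕ) (m : Fin (suc s) → ℕ) where

  Pile : Set
  Pile = Fin (suc s)

  Cfg : Set
  Cfg = Config w s

  Valid : Cfg → Set
  Valid = IsState w s m

  size : Cfg → Pile → ℕ
  size P k = length (P k)

  room : Cfg → Pile → ℕ
  room P k = m k ∸ size P k

  occurrences : Fin w → Cfg → ℕ
  occurrences x P = ∑ (λ k → occ x (P k))

  private
    concat-piles : (P : Cfg) → concat (map P (allFin (suc s))) ≡ concat (tabulate P)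
    concat-piles P = cong concat (map-tabulate id P)

  Valid⇒occurrences≡1 : ∀ {P} → Valid P → ∀ x → occurrences x P ≡ 1
  Valid⇒occurrences≡1 {P} st x = begin
    occurrences x P                         ≡⟨ occ-concat x P ⟨
    occ x (concat (tabulate P))             ≡⟨ cong (occ x) (concat-piles P) ⟨
    occ x (concat (map P (allFin (suc s)))) ≡⟨ occ-↭ x (IsState.partition st) ⟩
    occ x (allFin w)                        ≡⟨ occ-allFin x ⟩
    1                                       ∎
    where open ≡-Reasoning

  Valid⇒∑size≡w : ∀ {P} → Valid P → ∑ (size P) ≡ w
  Valid⇒∑size≡w {P} st = begin
    ∑ (size P)                                 ≡⟨ length-concat-tabulate P ⟨
    length (concat (tabulate P))               ≡⟨ cong length (concat-piles P) ⟨
    length (concat (map P (allFin (suc s))))   ≡⟨ ↭-length (IsState.partition st) ⟩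
    length (allFin w)                          ≡⟨ length-tabulate id ⟩
    w                                          ∎
    where open ≡-Reasoning

  occurrences≡1⇒Valid : ∀ {P} → (∀ x → occurrences x P ≡ 1) → (∀ k → size P k ≤ m k) → Valid P
  occurrences≡1⇒Valid {P} occ≡1 fits = record
    { partition = subst (_↭ allFin w) (sym (concat-piles P))
        (occ⇒↭ _ _ λ x → trans (occ-concat x P) (trans (occ≡1 x) (sym (occ-allFin x))))
    ; capacity  = fits
    }

  Valid-resp-≗ : ∀ {P Q} → Valid P → P ≗ Q → Valid Q
  Valid-resp-≗ {P} {Q} st P≗Q = occurrences≡1⇒Valid
    (λ x → trans (sum-cong-≗ (λ k → cong (occ x) (sym (P≗Q k)))) (Valid⇒occurrences≡1 st x))
    (λ k → subst (λ pile → length pile ≤ m k) (P≗Q k) (IsState.capacity st k))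

  Move⇒occurrences≡ : ∀ {P Q : Cfg} → Move P Q → ∀ x → occurrences x P ≡ occurrences x Q
  Move⇒occurrences≡ {P} {Q} (i , j , c , i≢j , Pᵢ , Qⱼ , P≗Q) x =
    ∑-transfer (λ k → occ x (P k)) (λ k → occ x (Q k)) i≢j
      (trans (cong (occ x) Pᵢ) (occ-++ x [ c ] _))
      (trans (cong (occ x) Qⱼ) (occ-++ x [ c ] _))
      (λ k k≢i k≢j → cong (occ x) (sym (P≗Q k k≢i k≢j)))

  Move⇒Valid : ∀ {P Q} → Valid P → Move P Q → (∀ k → size Q k ≤ m k) → Valid Q
  Move⇒Valid st mv fits = occurrences≡1⇒Valid
    (λ x → trans (sym (Move⇒occurrences≡ mv x)) (Valid⇒occurrences≡1 st x)) fits

  Move-resp-≗ : ∀ {P P′ Q Q′ : Cfg} → P ≗ P′ → Q ≗ Q′ → Move P Q → Move P′ Q′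
  Move-resp-≗ P≗P′ Q≗Q′ (i , j , c , i≢j , Pᵢ , Qⱼ , P≗Q) =
    i , j , c , i≢j ,
    trans (sym (P≗P′ i)) (trans Pᵢ (cong (c ∷_) (Q≗Q′ i))) ,
    trans (sym (Q≗Q′ j)) (trans Qⱼ (cong (c ∷_) (P≗P′ j))) ,
    λ k k≢i k≢j → trans (sym (Q≗Q′ k)) (trans (P≗Q k k≢i k≢j) (P≗P′ k))

  Edge-resp-≗ : ∀ {P P′ Q Q′} → P ≗ P′ → Q ≗ Q′ → Edge w s m P Q → Edge w s m P′ Q′
  Edge-resp-≗ P≗P′ Q≗Q′ (stP , stQ , mv) =
    Valid-resp-≗ stP P≗P′ , Valid-resp-≗ stQ Q≗Q′ ,
    Data.Sum.map (Move-resp-≗ P≗P′ Q≗Q′) (Move-resp-≗ Q≗Q′ P≗P′) mv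

  -- Configurations are functions, so distinct configurations may be pointwise equal.
  -- Reachability is taken up to _≗_; the equality steps are absorbed into real moves at
  -- the end, which is why a path is made to start with one move.
  Step : Cfg → Cfg → Set
  Step P Q = Edge w s m P Q ⊎ (Valid P × Valid Q × P ≗ Q)

  Reach : Cfg → Cfg → Set
  Reach = Star Step

  Reach-sym : ∀ {P Q} → Reach P Q → Reach Q P
  Reach-sym = Star.reverse λ
    { (inj₁ (stP , stQ , mv))  → inj₁ (stQ , stP , Data.Sum.swap mv)
    ; (inj₂ (stP , stQ , P≗Q)) → inj₂ (stQ , stP , λ k → sym (P≗Q k)) }

  ≗⇒Reach : ∀ {P Q} → Valid P → P ≗ Q → Reach P Q
  ≗⇒Reach st P≗Q = inj₂ (st , Valid-resp-≗ st P≗Q , P≗Q) ◅ ε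

  Reach⇒≗⊎Path : ∀ {P Q} → Reach P Q → P ≗ Q ⊎ Star (Edge w s m) P Q
  Reach⇒≗⊎Path ε = inj₁ (λ _ → refl)
  Reach⇒≗⊎Path (inj₁ edge ◅ r) with Reach⇒≗⊎Path r
  ... | inj₁ Q≗R  = inj₂ (Edge-resp-≗ (λ _ → refl) Q≗R edge ◅ ε)
  ... | inj₂ path = inj₂ (edge ◅ path)
  Reach⇒≗⊎Path (inj₂ (_ , _ , P≗Q) ◅ r) with Reach⇒≗⊎Path r
  ... | inj₁ Q≗R           = inj₁ (λ k → trans (P≗Q k) (Q≗R k))
  ... | inj₂ ε             = inj₁ P≗Q
  ... | inj₂ (edge ◅ path) = inj₂ (Edge-resp-≗ (λ k → sym (P≗Q k)) (λ _ → refl) edge ◅ path)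

  infixr 5 _on_
  _on_ : Cfg → Cfg → Cfg
  (V on B) k = V k ++ B k

  size-on : ∀ V B k → size (V on B) k ≡ size V k + size B k
  size-on V B k = length-++ (V k)

  record Moved (c : Fin w) (a b : Pile) (V V′ : Cfg) : Set where
    field
      source : V a ≡ c ∷ V′ a
      target : V′ b ≡ c ∷ V b
      rest   : ∀ k → k ≢ a → k ≢ b → V′ k ≡ V k

  Moved⇒Move : ∀ {c a b V V′} B → a ≢ b → Moved c a b V V′ → Move (V on B) (V′ on B)
  Moved⇒Move {c} {a} {b} B a≢b mv =
    a , b , c , a≢b , cong (_++ B a) source , cong (_++ B b) target , λ k k≢a k≢b → cong (_++ B k) (rest k k≢a k≢b)
    where open Moved mv

  move : Fin w → Pile → Pile → Cfg → Cfg
  move c a b V = updateAt (updateAt V a (drop 1)) b (c ∷_)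

  move-Moved : ∀ {c a b V r} → V a ≡ c ∷ r → a ≢ b → Moved c a b V (move c a b V)
  move-Moved {c} {a} {b} {V} Vₐ a≢b = record
    { source = trans Vₐ (cong (c ∷_) (sym (trans (updateAt-minimal a b _ a≢b)
                 (trans (updateAt-updates a V) (cong (drop 1) Vₐ)))))
    ; target = trans (updateAt-updates b _) (cong (c ∷_) (updateAt-minimal b a V (a≢b ∘ sym)))
    ; rest   = λ k k≢a k≢b → trans (updateAt-minimal k b _ k≢b) (updateAt-minimal k a V k≢a)
    }

  room+size : ∀ {P} → Valid P → ∀ k → room P k + size P k ≡ m k
  room+size st k = m∸n+n≡m (IsState.capacity st k)

  ∑room+∑size : ∀ {P} → (∀ k → size P k ≤ m k) → ∑ (room P) + ∑ (size P) ≡ ∑ m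
  ∑room+∑size {P} fits = trans (sym (∑-distrib-+ (room P) (size P))) (sum-cong-≗ (λ k → m∸n+n≡m (fits k)))

  ∑room+w : ∀ {P} → Valid P → ∑ (room P) + w ≡ ∑ m
  ∑room+w {P} st = trans (cong (∑ (room P) +_) (sym (Valid⇒∑size≡w st))) (∑room+∑size {P} (IsState.capacity st))

  ≮⇒room≡0 : ∀ P k → ¬ size P k < m k → room P k ≡ 0
  ≮⇒room≡0 P k ¬fits = m≤n⇒m∸n≡0 (≮⇒≥ ¬fits)

  0<room⇒fits : ∀ P k → 0 < room P k → size P k < m k
  0<room⇒fits P k 0<room = m∸n≢0⇒n<m (>⇒≢ 0<room)

  room-on : ∀ V B → Valid (V on B) → ∀ i → room (V on B) i + size V i ≡ room B i
  room-on V B st i = begin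
    r + size V i                         ≡⟨ m+n∸n≡m (r + size V i) (size B i) ⟨
    r + size V i + size B i ∸ size B i   ≡⟨ cong (_∸ size B i) (+-assoc r (size V i) (size B i)) ⟩
    r + (size V i + size B i) ∸ size B i ≡⟨ cong (λ n → r + n ∸ size B i) (size-on V B i) ⟨
    r + size (V on B) i ∸ size B i       ≡⟨ cong (_∸ size B i) (room+size st i) ⟩
    room B i                             ∎
    where
    open ≡-Reasoning
    r = room (V on B) i

  module Over (B : Cfg) (spacious : ∀ i → room B i + w ≤ ∑ m) where

    Good : Cfg → Set
    Good V = Valid (V on B)

    Reaches : Cfg → (Cfg → Set) → Set
    Reaches V P = ∃ λ V′ → Good V′ × Reach (V on B) (V′ on B) × P V′

    done : ∀ {V} {P : Cfg → Set} → Good V → P V → Reaches V P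
    done g p = _ , g , ε , p

    infixl 1 _⟫_
    _⟫_ : ∀ {V} {P Q : Cfg → Set} → Reaches V P → (∀ {V′} → Good V′ → P V′ → Reaches V′ Q) → Reaches V Q
    (_ , g , r , p) ⟫ next with V″ , g″ , r′ , q ← next g p = V″ , g″ , r ◅◅ r′ , q

    size-on-cong : ∀ k {l l′ : List (Fin w)} → l ≡ l′ → length (l ++ B k) ≡ length (l′ ++ B k)
    size-on-cong k = cong (λ l → length (l ++ B k))

    step : ∀ {V c a b r} → Good V → V a ≡ c ∷ r → a ≢ b → size (V on B) b < m b → Reaches V (Moved c a b V)
    step {V} {c} {a} {b} g Vₐ a≢b fits = V′ , g′ , inj₁ (g , g′ , inj₁ mv) ◅ ε , moved
      where
      V′ = move c a b V
      moved = move-Moved Vₐ a≢b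
      open Moved moved
      mv = Moved⇒Move B a≢b moved
      capacity : ∀ k → size (V′ on B) k ≤ m k
      capacity k with k ≟ᶠ a | k ≟ᶠ b
      ... | yes refl | _        = ≤-trans (n≤1+n _) (subst (_≤ m k) (size-on-cong k source) (IsState.capacity g k))
      ... | no _     | yes refl = subst (_≤ m k) (sym (size-on-cong k target)) fits
      ... | no k≢a   | no k≢b   = subst (_≤ m k) (size-on-cong k (sym (rest k k≢a k≢b))) (IsState.capacity g k)
      g′ : Good V′
      g′ = Move⇒Valid g mv capacity

    spare : ∀ {V} → Good V → ∀ i → size V i + room (V on B) i ≤ ∑ (room (V on B))
    spare {V} g i = +-cancelʳ-≤ w _ _ (begin
      size V i + room (V on B) i + w  ≡⟨ cong (_+ w) (trans (+-comm (size V i) _) (room-on V B g i)) ⟩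
      room B i + w                    ≤⟨ spacious i ⟩
      ∑ m                             ≡⟨ ∑room+w g ⟨
      ∑ (room (V on B)) + w           ∎)
      where open ≤-Reasoning

    room-elsewhere : ∀ {V i} → Good V → 0 < size V i → ∃ λ k → k ≢ i × size (V on B) k < m k
    room-elsewhere {V} {i} g nonempty with any? (λ k → ¬? (k ≟ᶠ i) ×-dec (size (V on B) k <? m k))
    ... | yes found = found
    ... | no  none  = contradiction (begin-strict
      room (V on B) i                 <⟨ +-monoˡ-≤ (room (V on B) i) nonempty ⟩
      size V i + room (V on B) i      ≤⟨ spare g i ⟩
      ∑ (room (V on B))               ≤⟨ ∑-support₁ (room (V on B)) i (λ k k≢i → ≮⇒room≡0 (V on B) k (λ fits → none (k , k≢i , fits))) ⟩
      room (V on B) i                 ∎) (<-irrefl refl)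
      where open ≤-Reasoning

    uncover : ∀ {V i c} xs ys → Good V → V i ≡ xs ++ c ∷ ys → Reaches V (λ V′ → V′ i ≡ c ∷ ys)
    uncover []       ys g Vᵢ = done g Vᵢ
    uncover (x ∷ xs) ys g Vᵢ with k , k≢i , fits ← room-elsewhere g (∷⇒0<length Vᵢ) =
      step g Vᵢ (k≢i ∘ sym) fits ⟫ λ g′ mv → uncover xs ys g′ (∷-injectiveʳ (trans (sym (Moved.source mv)) Vᵢ))

    unload : ∀ {V i j} l → i ≢ j → Good V → V j ≡ l → length l + size (V on B) i ≤ m i →
             Reaches V (λ V′ → V′ j ≡ [] × (∀ k → k ≢ i → k ≢ j → V′ k ≡ V k))
    unload []       i≢j g Vⱼ fits = done g (Vⱼ , λ _ _ _ → refl)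
    unload {V} {i} {j} (d ∷ ds) i≢j g Vⱼ fits =
      step g Vⱼ (i≢j ∘ sym) (≤-trans (s≤s (m≤n+m _ _)) fits) ⟫ λ {V₁} g₁ mv₁ →
      let open Moved mv₁ in
      unload ds i≢j g₁ (∷-injectiveʳ (trans (sym source) Vⱼ))
        (subst (λ n → length ds + n ≤ m i) (sym (size-on-cong i target)) (subst (_≤ m i) (sym (+-suc _ _)) fits)) ⟫ λ g₂ (empty , rest₂) →
      done g₂ (empty , λ k k≢i k≢j → trans (rest₂ k k≢i k≢j) (rest k k≢j k≢i))

    fits-after-pop : ∀ {V V′ : Cfg} {a x l} → Good V → V a ≡ x ∷ l → V′ a ≡ l → size (V′ on B) a < m a
    fits-after-pop {a = a} g Vₐ V′ₐ =
      subst (λ n → suc n ≤ m a) (size-on-cong a (sym V′ₐ)) (subst (_≤ m a) (size-on-cong a Vₐ) (IsState.capacity g a))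

    crowded-bound : ∀ {V i j} → Good V → (∀ k → k ≢ i → k ≢ j → room (V on B) k ≡ 0) → size V i ≤ room (V on B) j
    crowded-bound {V} {i} {j} g full = +-cancelˡ-≤ (room (V on B) i) _ _ (begin
      room (V on B) i + size V i           ≡⟨ +-comm (room (V on B) i) (size V i) ⟩
      size V i + room (V on B) i           ≤⟨ spare g i ⟩
      ∑ (room (V on B))                    ≤⟨ ∑-support₂ (room (V on B)) i j full ⟩
      room (V on B) i + room (V on B) j    ∎)
      where open ≤-Reasoning

    module Isolate (third : ∀ {V i j} → Good V → i ≢ j → 0 < size V i → 0 < size V j →
                            ∃ λ k → k ≢ i × k ≢ j × size B k < m k) where

      -- With no room outside piles i and j, the top card c of pile i reaches the bottom of
      -- pile j via a third pile k, which is full only because of free cards: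
      -- c to j, top of k to i, c to k, the rest of j onto i, c back to j.
      isolate-crowded : ∀ {V i j c zs d ds} → i ≢ j → size B j < m j → Good V → V i ≡ c ∷ zs → V j ≡ d ∷ ds →
                        (∀ k → k ≢ i → k ≢ j → room (V on B) k ≡ 0) → Reaches V (λ V′ → V′ j ≡ [ c ])
      isolate-crowded {V} {i} {j} {c} {zs} {d} {ds} i≢j fitsⱼ g Vᵢ Vⱼ full
        with k , k≢i , k≢j , nonfullₖ ← third g i≢j (∷⇒0<length Vᵢ) (∷⇒0<length Vⱼ) | V k in Vₖ
      ... | [] = contradiction (subst (m k ≤_) (size-on-cong k Vₖ) (m∸n≡0⇒m≤n (full k k≢i k≢j))) (<⇒≱ nonfullₖ)
      ... | e ∷ es =
        step g Vᵢ i≢j (0<room⇒fits (V on B) j (<-≤-trans (∷⇒0<length Vᵢ) (crowded-bound g full))) ⟫ λ {V₁} g₁ mv₁ →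
        let module M₁ = Moved mv₁
            V₁ᵢ = ∷-injectiveʳ (trans (sym M₁.source) Vᵢ)
            V₁ₖ = trans (M₁.rest k k≢i k≢j) Vₖ in
        step g₁ V₁ₖ k≢i (fits-after-pop {V′ = V₁} g Vᵢ V₁ᵢ) ⟫ λ {V₂} g₂ mv₂ →
        let module M₂ = Moved mv₂
            V₂ₖ = ∷-injectiveʳ (trans (sym M₂.source) V₁ₖ)
            V₂ⱼ = trans (M₂.rest j (k≢j ∘ sym) (i≢j ∘ sym)) (trans M₁.target (cong (c ∷_) Vⱼ)) in
        step g₂ V₂ⱼ (k≢j ∘ sym) (fits-after-pop {V′ = V₂} g Vₖ V₂ₖ) ⟫ λ {V₃} g₃ mv₃ →
        let module M₃ = Moved mv₃
            V₃ⱼ = ∷-injectiveʳ (trans (sym M₃.source) V₂ⱼ)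
            V₃ᵢ = trans (M₃.rest i i≢j (k≢i ∘ sym)) (trans M₂.target (cong (e ∷_) V₁ᵢ)) in
        unload (d ∷ ds) i≢j g₃ V₃ⱼ (begin
          length (d ∷ ds) + size (V₃ on B) i ≡⟨ cong₂ _+_ (cong length (sym Vⱼ)) (trans (size-on-cong i V₃ᵢ) (size-on-cong i (sym Vᵢ))) ⟩
          size V j + size (V on B) i         ≤⟨ +-monoˡ-≤ (size (V on B) i) (crowded-bound g (λ k k≢j k≢i → full k k≢i k≢j)) ⟩
          room (V on B) i + size (V on B) i  ≡⟨ room+size g i ⟩
          m i                                ∎) ⟫ λ {V₄} g₄ (empty₄ , rest₄) →
        step g₄ (trans (rest₄ k k≢i k≢j) (trans M₃.target (cong (c ∷_) V₂ₖ))) k≢j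
          (subst (_< m j) (sym (size-on-cong j empty₄)) fitsⱼ) ⟫ λ g₅ mv₅ →
        done g₅ (trans (Moved.target mv₅) (cong (c ∷_) empty₄))
        where open ≤-Reasoning

      isolate-from-top : ∀ {V i j c zs} l → i ≢ j → size B j < m j → Good V → V i ≡ c ∷ zs → V j ≡ l →
                         Reaches V (λ V′ → V′ j ≡ [ c ])
      isolate-from-top {j = j} {c} [] i≢j fitsⱼ g Vᵢ Vⱼ =
        step g Vᵢ i≢j (subst (_< m j) (sym (size-on-cong j Vⱼ)) fitsⱼ) ⟫ λ g′ mv →
        done g′ (trans (Moved.target mv) (cong (c ∷_) Vⱼ))
      isolate-from-top {V} {i} {j} (d ∷ ds) i≢j fitsⱼ g Vᵢ Vⱼ
        with any? (λ k → ¬? (k ≟ᶠ i) ×-dec (¬? (k ≟ᶠ j) ×-dec (size (V on B) k <? m k)))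
      ... | yes (k , k≢i , k≢j , fitsₖ) =
        step g Vⱼ (k≢j ∘ sym) fitsₖ ⟫ λ g′ mv →
        let open Moved mv in
        isolate-from-top ds i≢j fitsⱼ g′ (trans (rest i i≢j (k≢i ∘ sym)) Vᵢ) (∷-injectiveʳ (trans (sym source) Vⱼ))
      ... | no none =
        isolate-crowded i≢j fitsⱼ g Vᵢ Vⱼ (λ k k≢i k≢j → ≮⇒room≡0 (V on B) k (λ fits → none (k , k≢i , k≢j , fits)))

      isolate-uncovered : ∀ {V a j c ys} → size B j < m j → Good V → V a ≡ c ∷ ys → Reaches V (λ V′ → V′ j ≡ [ c ])
      isolate-uncovered {a = a} {j} fitsⱼ g Vₐ with a ≟ᶠ j
      ... | no a≢j = isolate-from-top _ a≢j fitsⱼ g Vₐ refl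
      isolate-uncovered {ys = []}    fitsⱼ g Vₐ | yes refl = done g Vₐ
      isolate-uncovered {ys = _ ∷ _} fitsⱼ g Vₐ | yes refl with k , k≢a , fitsₖ ← room-elsewhere g (∷⇒0<length Vₐ) =
        step g Vₐ (k≢a ∘ sym) fitsₖ ⟫ λ g′ mv → isolate-from-top _ k≢a fitsⱼ g′ (Moved.target mv) refl

      isolate : ∀ {V a j c} → size B j < m j → Good V → c ∈ V a → Reaches V (λ V′ → V′ j ≡ [ c ])
      isolate fitsⱼ g c∈ with xs , ys , Vₐ ← ∈-∃++ c∈ = uncover xs ys g Vₐ ⟫ isolate-uncovered fitsⱼ

  free-count : ∀ V B {n} → Valid (V on B) → ∑ (size B) + n ≡ w → ∑ (size V) ≡ n
  free-count V B {n} st settled = +-cancelˡ-≡ (∑ (size B)) _ _ (begin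
    ∑ (size B) + ∑ (size V)         ≡⟨ +-comm (∑ (size B)) (∑ (size V)) ⟩
    ∑ (size V) + ∑ (size B)         ≡⟨ ∑-distrib-+ (size V) (size B) ⟨
    ∑ (λ k → size V k + size B k)   ≡⟨ sum-cong-≗ (λ k → sym (size-on V B k)) ⟩
    ∑ (size (V on B))               ≡⟨ Valid⇒∑size≡w st ⟩
    w                               ≡⟨ settled ⟨
    ∑ (size B) + n                  ∎)
    where open ≡-Reasoning

  occurrences-on : ∀ V B x → occurrences x (V on B) ≡ ∑ (λ k → occ x (V k)) + occurrences x B
  occurrences-on V B x = trans (sum-cong-≗ (λ k → occ-++ x (V k) (B k))) (∑-distrib-+ (λ k → occ x (V k)) (λ k → occ x (B k)))

  free-stays-free : ∀ V V′ B {a c} → Valid (V on B) → Valid (V′ on B) → c ∈ V a → ∃ λ b → c ∈ V′ b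
  free-stays-free V V′ B {a} {c} st st′ c∈ =
    Data.Product.map₂ (occ>0⇒∈ _) (∑>0⇒∃>0 (λ k → occ c (V′ k)) (begin
      1                                              ≡⟨ Valid⇒occurrences≡1 st′ c ⟨
      occurrences c (V′ on B)                        ≡⟨ occurrences-on V′ B c ⟩
      ∑ (λ k → occ c (V′ k)) + occurrences c B       ≡⟨ cong (∑ (λ k → occ c (V′ k)) +_) settled≡0 ⟩
      ∑ (λ k → occ c (V′ k)) + 0                     ≡⟨ +-identityʳ _ ⟩
      ∑ (λ k → occ c (V′ k))                         ∎))
    where
    open ≤-Reasoning
    settled≡0 : occurrences c B ≡ 0
    settled≡0 = n≤0⇒n≡0 (+-cancelˡ-≤ 1 _ _ (begin
      1 + occurrences c B                            ≤⟨ +-monoˡ-≤ _ (≤-trans (∈⇒occ>0 c∈) (∑-lookup (λ k → occ c (V k)) a)) ⟩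
      ∑ (λ k → occ c (V k)) + occurrences c B        ≡⟨ occurrences-on V B c ⟨
      occurrences c (V on B)                         ≡⟨ Valid⇒occurrences≡1 st c ⟩
      1                                              ≡⟨ +-identityʳ 1 ⟨
      1 + 0                                          ∎))

  settle : Fin w → Pile → Cfg → Cfg
  settle c j B = updateAt B j (c ∷_)

  settle-≗ : ∀ W B j {c} → W j ≡ [ c ] → (updateAt W j (λ _ → []) on settle c j B) ≗ (W on B)
  settle-≗ W B j Wⱼ k with k ≟ᶠ j
  ... | yes refl = trans (cong₂ _++_ (updateAt-updates k W) (updateAt-updates k B)) (cong (_++ B k) (sym Wⱼ))
  ... | no  k≢j  = cong₂ _++_ (updateAt-minimal k j W k≢j) (updateAt-minimal k j B k≢j)

  record Invariant (n : ℕ) (B : Cfg) : Set where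
    field
      settled  : ∑ (size B) + n ≡ w
      spacious : ∀ i → room B i + w ≤ ∑ m
      besides  : 2 ≤ n → PositiveBesides (room B)

  settle-Invariant : ∀ {n B j c} → (∀ k → size B k ≤ m k) → (∀ k → room B k ≤ room B j) → 0 < room B j →
                     Invariant (suc n) B → Invariant n (settle c j B)
  settle-Invariant {n} {B} {j} {c} fits max 0<roomⱼ inv = record
    { settled  = settled′
    ; spacious = λ i → ≤-trans (+-monoˡ-≤ w (∸-monoʳ-≤ (m i) (size≤ i))) (spacious i)
    ; besides  = λ 2≤n → PositiveBesides-pred (room B) (room B′) j max
        (trans (m∸n≡1+[m∸1+n] (0<room⇒fits B j 0<roomⱼ)) (cong (λ l → suc (m j ∸ length l)) (sym (updateAt-updates j B))))
        (λ k k≢j → cong (λ l → m k ∸ length l) (updateAt-minimal k j B k≢j))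
        (≤-trans (+-mono-≤ 0<roomⱼ 2≤n) (roomⱼ+n≤∑room′))
        (besides (≤-trans 2≤n (n≤1+n n)))
    }
    where
    open Invariant inv
    B′ = settle c j B
    size≤ : ∀ k → size B k ≤ size B′ k
    size≤ k with k ≟ᶠ j
    ... | yes refl = ≤-trans (n≤1+n _) (≤-reflexive (cong length (sym (updateAt-updates k B))))
    ... | no  k≢j  = ≤-reflexive (cong length (sym (updateAt-minimal k j B k≢j)))
    fits′ : ∀ k → size B′ k ≤ m k
    fits′ k with k ≟ᶠ j
    ... | yes refl = subst (_≤ m k) (cong length (sym (updateAt-updates k B))) (0<room⇒fits B k 0<roomⱼ)
    ... | no  k≢j  = subst (_≤ m k) (cong length (sym (updateAt-minimal k j B k≢j))) (fits k)
    ∑size′ : ∑ (size B′) ≡ suc (∑ (size B))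
    ∑size′ = ∑-update (size B) (size B′) j (λ k k≢j → cong length (sym (updateAt-minimal k j B k≢j)))
               (cong length (updateAt-updates j B))
    settled′ : ∑ (size B′) + n ≡ w
    settled′ = trans (cong (_+ n) ∑size′) (trans (sym (+-suc _ n)) settled)
    roomⱼ+n≤∑room′ : room B j + n ≤ ∑ (room B′)
    roomⱼ+n≤∑room′ = +-cancelʳ-≤ (∑ (size B′)) _ _ (begin
      room B j + n + ∑ (size B′)     ≡⟨ +-assoc (room B j) n _ ⟩
      room B j + (n + ∑ (size B′))   ≡⟨ cong (room B j +_) (trans (+-comm n _) settled′) ⟩
      room B j + w                   ≤⟨ spacious j ⟩
      ∑ m                            ≡⟨ ∑room+∑size {B′} fits′ ⟨
      ∑ (room B′) + ∑ (size B′)      ∎)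
      where open ≤-Reasoning

  size-base≤m : ∀ V B → Valid (V on B) → ∀ k → size B k ≤ m k
  size-base≤m V B st k = ≤-trans (m≤n+m _ _) (subst (_≤ m k) (size-on V B k) (IsState.capacity st k))

  besides⇒third : ∀ {n B} → Invariant n B → ∀ {V i j} → Valid (V on B) → i ≢ j → 0 < size V i → 0 < size V j →
                  ∃ λ k → k ≢ i × k ≢ j × size B k < m k
  besides⇒third {n} {B} inv {V} {i} {j} st i≢j 0<sizeᵢ 0<sizeⱼ =
    let k , k≢i , k≢j , 0<roomₖ = Invariant.besides inv (begin
          2                   ≤⟨ +-mono-≤ 0<sizeᵢ 0<sizeⱼ ⟩
          size V i + size V j ≤⟨ ∑-lookup₂ (size V) i≢j ⟩
          ∑ (size V)          ≡⟨ free-count V B st (Invariant.settled inv) ⟩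
          n                   ∎) i j
    in k , k≢i , k≢j , 0<room⇒fits B k 0<roomₖ
    where open ≤-Reasoning

  isolate-and-settle : ∀ {n B j c} → Invariant (suc n) B → 0 < room B j → ∀ {V a} → Valid (V on B) → c ∈ V a →
                       ∃ λ V′ → Valid (V′ on settle c j B) × Reach (V on B) (V′ on settle c j B)
  isolate-and-settle {B = B} {j} inv 0<roomⱼ {V} {a} st c∈ =
    let W , g , r , Wⱼ = isolate {a = a} (0<room⇒fits B j 0<roomⱼ) st c∈
        settled≗ = λ k → sym (settle-≗ W B j Wⱼ k)
    in updateAt W j (λ _ → []) , Valid-resp-≗ g settled≗ , r ◅◅ ≗⇒Reach g settled≗
    where
    open Over B (Invariant.spacious inv)
    open Isolate (besides⇒third inv)

  connected-over : ∀ n {B} → Invariant n B → ∀ {V V′} → Valid (V on B) → Valid (V′ on B) → Reach (V on B) (V′ on B)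
  connected-over zero {B} inv {V} {V′} st st′ =
    ≗⇒Reach st (λ k → cong (_++ B k) (trans (no-free st k) (sym (no-free st′ k))))
    where
    no-free : ∀ {V} → Valid (V on B) → ∀ k → V k ≡ []
    no-free {V} st k = length≡0⇒[] (V k) (∑≡0⇒zero (size V) (free-count V B st (Invariant.settled inv)) k)
  connected-over (suc n) {B} inv {V₁} {V₂} st₁ st₂ =
    let a , 0<sizeₐ = ∑>0⇒∃>0 (size V₁) (subst (0 <_) (sym (free-count V₁ B st₁ (Invariant.settled inv))) (s≤s z≤n))
        c , c∈₁     = 0<length⇒∃∈ {l = V₁ a} 0<sizeₐ
        b , c∈₂     = free-stays-free V₁ V₂ B st₁ st₂ c∈₁
        j , max     = argmax (room B)
        0<roomⱼ     = ≤-trans 0<sizeₐ (≤-trans (m≤n+m _ _) (≤-trans (≤-reflexive (room-on V₁ B st₁ a)) (max a)))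
        _ , g₁ , r₁ = isolate-and-settle {j = j} inv 0<roomⱼ st₁ c∈₁
        _ , g₂ , r₂ = isolate-and-settle {j = j} inv 0<roomⱼ st₂ c∈₂
    in r₁ ◅◅ connected-over n (settle-Invariant (size-base≤m V₁ B st₁) max 0<roomⱼ inv) g₁ g₂ ◅◅ Reach-sym r₂

  empty : Cfg
  empty _ = []

  on-empty : ∀ V → (V on empty) ≗ V
  on-empty V k = ++-identityʳ (V k)

  reachable : (∀ i → m i + w ≤ ∑ m) → (2 ≤ w → PositiveBesides m) → ∀ {P Q} → Valid P → Valid Q → Reach P Q
  reachable spacious besides {P} {Q} stP stQ =
    ≗⇒Reach stP (λ k → sym (on-empty P k)) ◅◅
    connected-over w {empty} inv (Valid-resp-≗ stP (λ k → sym (on-empty P k))) (Valid-resp-≗ stQ (λ k → sym (on-empty Q k))) ◅◅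
    ≗⇒Reach (Valid-resp-≗ stQ (λ k → sym (on-empty Q k))) (on-empty Q)
    where
    inv : Invariant w empty
    inv = record
      { settled  = cong (_+ w) (∑-zero (size empty) (λ _ → refl))
      ; spacious = spacious
      ; besides  = besides
      }

  some-edge : (∀ i → m i + w ≤ ∑ m) → 0 < w → ∀ {P} → Valid P → ∃ λ P′ → Edge w s m P P′
  some-edge spacious 0<w {P} st =
    let i , 0<sizeᵢ       = ∑>0⇒∃>0 (size P) (subst (0 <_) (sym (Valid⇒∑size≡w st)) 0<w)
        c , r , Pᵢ        = 0<length⇒∷ 0<sizeᵢ
        k , k≢i , fitsₖ   = room-elsewhere g 0<sizeᵢ
        P′ , g′ , _ , moved = step g Pᵢ (k≢i ∘ sym) fitsₖ
    in P′ , st , Valid-resp-≗ g′ (on-empty P′) ,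
       inj₁ (Move-resp-≗ (on-empty P) (on-empty P′) (Moved⇒Move empty (k≢i ∘ sym) moved))
    where
    open Over empty spacious
    g : Valid (P on empty)
    g = Valid-resp-≗ st (λ k → sym (on-empty P k))

  Edge◅Reach⇒Path : ∀ {P Q R} → Edge w s m P Q → Reach Q R → Star (Edge w s m) P R
  Edge◅Reach⇒Path edge r with Reach⇒≗⊎Path r
  ... | inj₁ Q≗R  = Edge-resp-≗ (λ _ → refl) Q≗R edge ◅ ε
  ... | inj₂ path = edge ◅ path

  connected : (∀ i → m i + w ≤ ∑ m) → (2 ≤ w → PositiveBesides m) → 0 < w → Connected w s m
  connected spacious besides 0<w S T =
    let _ , edge = some-edge spacious 0<w (isState S) in
    Edge◅Reach⇒Path edge (reachable spacious besides (proj₁ (proj₂ edge)) (isState T))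

  state-exists : w ≤ ∑ m → Σ Cfg Valid
  state-exists fit = fill m (allFin w) , occurrences≡1⇒Valid
    (λ x → trans (sym (occ-concat x (fill m (allFin w))))
             (trans (cong (occ x) (fill-concat m (allFin w) (subst (_≤ ∑ m) (sym (length-tabulate id)) fit))) (occ-allFin x)))
    (length-fill m (allFin w))

  relabel : (Fin w → Fin w) → Cfg → Cfg
  relabel σ P k = map σ (P k)

  Valid-relabel : ∀ {σ τ P} → (∀ x → σ (τ x) ≡ x) → (∀ x → τ (σ x) ≡ x) → Valid P → Valid (relabel σ P)
  Valid-relabel {σ} {τ} {P} στ τσ st = occurrences≡1⇒Valid
    (λ x → begin
      ∑ (λ k → occ x (map σ (P k)))       ≡⟨ sum-cong-≗ (λ k → cong (λ y → occ y (map σ (P k))) (sym (στ x))) ⟩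
      ∑ (λ k → occ (σ (τ x)) (map σ (P k))) ≡⟨ sum-cong-≗ (λ k → occ-map σ σ-injective (τ x) (P k)) ⟩
      occurrences (τ x) P                 ≡⟨ Valid⇒occurrences≡1 st (τ x) ⟩
      1                                   ∎)
    (λ k → subst (_≤ m k) (sym (length-map σ (P k))) (IsState.capacity st k))
    where
    open ≡-Reasoning
    σ-injective : ∀ {a b} → σ a ≡ σ b → a ≡ b
    σ-injective {a} {b} σa≡σb = trans (sym (τσ a)) (trans (cong τ σa≡σb) (τσ b))

  Connected⇒invariant : Connected w s m → ∀ {X : Set} (I : Cfg → X) →
                        (∀ {P Q} → Valid P → Valid Q → Move P Q → I P ≡ I Q) →
                        ∀ {P Q} → Valid P → Valid Q → I P ≡ I Q
  Connected⇒invariant conn I move-invariant {P} {Q} stP stQ =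
    along (conn (record { piles = P ; isState = stP }) (record { piles = Q ; isState = stQ }))
    where
    along : ∀ {P Q} → Star (Edge w s m) P Q → I P ≡ I Q
    along ε                               = refl
    along ((stP , stQ , inj₁ mv) ◅ path) = trans (move-invariant stP stQ mv) (along path)
    along ((stP , stQ , inj₂ mv) ◅ path) = trans (sym (move-invariant stQ stP mv)) (along path)

  crowded⇒nonempty : ∀ {p P} → ∑ m < w + m p → Valid P → 0 < size P p
  crowded⇒nonempty {p} {P} crowded st with size P p in sizeₚ
  ... | suc _ = s≤s z≤n
  ... | zero  = contradiction crowded (≤⇒≯ (begin
    w + m p                ≡⟨ +-comm w (m p) ⟩
    m p + w                ≡⟨ cong (λ n → m p ∸ n + w) sizeₚ ⟨
    room P p + w           ≤⟨ +-monoˡ-≤ w (∑-lookup (room P) p) ⟩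
    ∑ (room P) + w         ≡⟨ ∑room+w st ⟩
    ∑ m                    ∎))
    where open ≤-Reasoning

  bottom-invariant : ∀ {p P Q} → ∑ m < w + m p → Valid P → Valid Q → Move P Q → last (P p) ≡ last (Q p)
  bottom-invariant {p} {P} {Q} crowded stP stQ (i , j , c , i≢j , Pᵢ , Qⱼ , rest) with p ≟ᶠ i | p ≟ᶠ j
  ... | yes refl | _        = trans (cong last Pᵢ) (last-∷ (Q p) (crowded⇒nonempty crowded stQ))
  ... | no _     | yes refl = sym (trans (cong last Qⱼ) (last-∷ (P p) (crowded⇒nonempty crowded stP)))
  ... | no p≢i   | no p≢j   = cong last (sym (rest p p≢i p≢j))

  ¬connected-crowded : ∀ p → ∑ m < w + m p → 2 ≤ w → w ≤ ∑ m → ¬ Connected w s m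
  ¬connected-crowded p crowded 2≤w fit conn =
    let P , st = state-exists fit
        b , lastₚ = last-just {l = P p} (crowded⇒nonempty {p} crowded st)
        b′ , b′≢b = another 2≤w b
        σ = transpose b b′
    in b′≢b (just-injective (begin
      just b′                             ≡⟨ cong just (transpose-matchˡ b b′) ⟨
      just (σ b)                          ≡⟨ cong (Data.Maybe.map σ) lastₚ ⟨
      Data.Maybe.map σ (last (P p))       ≡⟨ last-map σ (P p) ⟨
      last (relabel σ P p)                ≡⟨ Connected⇒invariant conn (λ P → last (P p)) (bottom-invariant crowded) st
                                              (Valid-relabel {transpose b b′} {transpose b′ b} (λ _ → transpose-inverse b b′) (λ _ → transpose-inverse b′ b) st) ⟨
      last (P p)                          ≡⟨ lastₚ ⟩
      just b                              ∎))
    where open ≡-Reasoning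

module TwoPiles (w : ℕ) (m : Fin 2 → ℕ) where
  open Piles w 1 m

  word : Cfg → List (Fin w)
  word P = P zero ʳ++ P (suc zero)

  word-invariant : ∀ {P Q} → Move P Q → word P ≡ word Q
  word-invariant {P} {Q} (zero     , suc zero , c , _ , P₀ , Q₁ , _) rewrite P₀ | Q₁ = refl
  word-invariant {P} {Q} (suc zero , zero     , c , _ , P₁ , Q₀ , _) rewrite P₁ | Q₀ = refl
  word-invariant (zero     , zero     , _ , 0≢0 , _) = contradiction refl 0≢0
  word-invariant (suc zero , suc zero , _ , 1≢1 , _) = contradiction refl 1≢1

  length-word : ∀ {P} → Valid P → length (word P) ≡ w
  length-word {P} st = trans (length-ʳ++ (P zero)) (trans (cong (size P zero +_) (sym (+-identityʳ _))) (Valid⇒∑size≡w st))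

  ¬connected : 2 ≤ w → w ≤ ∑ m → ¬ Connected w 1 m
  ¬connected 2≤w fit conn =
    let P , st = state-exists fit
        a , rest , wordP = 0<length⇒∷ {l = word P} (subst (0 <_) (sym (length-word st)) (≤-trans (s≤s z≤n) 2≤w))
        b , b≢a = another 2≤w a
        σ = transpose a b
    in b≢a (∷-injectiveˡ (begin
      b ∷ map σ rest                     ≡⟨ cong (_∷ map σ rest) (transpose-matchˡ a b) ⟨
      map σ (a ∷ rest)                   ≡⟨ cong (map σ) wordP ⟨
      map σ (word P)                     ≡⟨ map-ʳ++ σ (P zero) ⟩
      word (relabel σ P)                 ≡⟨ Connected⇒invariant conn word (λ _ _ → word-invariant) st
                                              (Valid-relabel {transpose a b} {transpose b a} (λ _ → transpose-inverse a b) (λ _ → transpose-inverse b a) st) ⟨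
      word P                             ≡⟨ wordP ⟩
      a ∷ rest                           ∎))
    where open ≡-Reasoning

lemma3 : (w s : ℕ) (m : Fin (suc s) → ℕ) →
    w ≥ 1 → s ≥ 1 → (∀ i → m i ≥ 1) → w ≤ sumM m →
    (w ≡ 1 → Connected w s m) ×
    (w > 1 → s ≡ 1 → ¬ Connected w s m) ×
    (w > 1 → s > 1 → (Connected w s m ⇔ (sumM m ≥ w + maxM m)))
lemma3 w s m w≥1 s≥1 m≥1 w≤sumM = one-card , two-piles , many-piles
  where
  open Piles w s m
  fit : w ≤ ∑ m
  fit = subst (w ≤_) (sumM≡∑ m) w≤sumM
  one-card : w ≡ 1 → Connected w s m
  one-card refl = connected spacious (λ { (s≤s ()) }) w≥1
    where
    spacious : ∀ i → m i + 1 ≤ ∑ m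
    spacious i = let j , j≢i = another (s≤s s≥1) i in ≤-trans (+-monoʳ-≤ (m i) (m≥1 j)) (∑-lookup₂ m (j≢i ∘ sym))
  two-piles : w > 1 → s ≡ 1 → ¬ Connected w s m
  two-piles w>1 refl = TwoPiles.¬connected w m w>1 fit
  many-piles : w > 1 → s > 1 → (Connected w s m ⇔ (sumM m ≥ w + maxM m))
  many-piles w>1 s>1 = mk⇔ necessary sufficient
    where
    necessary : Connected w s m → sumM m ≥ w + maxM m
    necessary conn with w + maxM m ≤? sumM m
    ... | yes roomy = roomy
    ... | no  ¬roomy = let p , maxₚ = maxM-attained m in
      contradiction conn (¬connected-crowded p (subst₂ (λ a b → a < w + b) (sumM≡∑ m) maxₚ (≰⇒> ¬roomy)) w>1 fit)
    sufficient : sumM m ≥ w + maxM m → Connected w s m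
    sufficient roomy = connected
      (λ i → subst₂ _≤_ (+-comm w (m i)) (sumM≡∑ m) (≤-trans (+-monoʳ-≤ w (≤maxM m i)) roomy))
      (λ _ a b → let k , k≢a , k≢b = another₂ (s≤s s>1) a b in k , k≢a , k≢b , m≥1 k)
      w≥1
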